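{- Let $p_1$ and $p_2$ be distinct primes with $p_1\equiv p_2\equiv 3\pmod 4$ and $p_1p_2\equiv 5\pmod 8$. Suppose the fundamental unit of $\mathcal{O}_{p_1p_2}$ (the ring of integers of $\mathbb{Q}(\sqrt{p_1p_2})$) is $\varepsilon_{p_1p_2}=\frac{t+u\sqrt{p_1p_2}}{2}$ with positive integers $t\equiv u\equiv 1\pmod 2$. Then $t\equiv 1\pmod 4$.
   Context: The fundamental unit $\varepsilon_{p_1p_2}>1$ is written as $(t+u\sqrt{p_1p_2})/2$ with positive integers $t\equiv u\pmod 2$. -}

module Defs where

open import Data.Nat as ℕ using (ℕ)
open import Data.Integer using (ℤ; +_; -_; _+_; _-_; _*_; _≤_; _<_; 0ℤ)
open import Data.Integer.Divisibility using (_∣_)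
open import Data.Product using (_×_)
open import Data.Sum using (_⊎_)
open import Relation.Binary.PropositionalEquality using (_≡_)

_≡_[mod_] : ℤ → ℤ → ℤ → Set
a ≡ b [mod m ] = m ∣ (a - b)

-- X ≤ Y·√d  (for d ≥ 0), decided exactly using only integer arithmetic.
LeSqrt : ℤ → ℤ → ℤ → Set
LeSqrt d X Y =
  (0ℤ ≤ Y × (X ≤ 0ℤ ⊎ X * X ≤ d * (Y * Y)))
  ⊎ (Y < 0ℤ × X ≤ 0ℤ × d * (Y * Y) ≤ X * X)

-- a + b√d ≤ c + e√d  as real numbers.
LeQ : ℤ → ℤ → ℤ → ℤ → ℤ → Set
LeQ d a b c e = LeSqrt d (a - c) (e - b)

LtQ : ℤ → ℤ → ℤ → ℤ → ℤ → Set
LtQ d a b c e = LeQ d c e a b → Data.Empty.⊥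
  where import Data.Empty

-- For d ≡ 1 (mod 4) squarefree, the ring of integers of ℚ(√d) is
-- {(x + y√d)/2 : x ≡ y (mod 2)}, and such an element is a unit iff its
-- norm (x² - d y²)/4 is ±1, i.e. x² - d y² = ±4.
IsUnitO : ℤ → ℤ → ℤ → Set
IsUnitO d x y =
  x ≡ y [mod + 2 ] × (x * x - d * (y * y) ≡ + 4 ⊎ x * x - d * (y * y) ≡ - + 4)

IsFundamentalUnit : ℤ → ℤ → ℤ → Set
IsFundamentalUnit d t u =
  IsUnitO d t u
  × LtQ d (+ 2) 0ℤ t u
  × (∀ (t′ u′ : ℤ) → IsUnitO d t′ u′ → LtQ d (+ 2) 0ℤ t′ u′ → LeQ d t u t′ u′)

{-# OPTIONS --safe #-}
module Submission where

-- Write d = p₁p₂. The norm t² − du² = −4 is impossible because −4 is not a square modulo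
-- p₁ ≡ 3 (mod 4). Hence t² − 4 = du²; t = 1 is trivial, and otherwise t = X + 2 with X odd,
-- X(X + 4) = du² and X, X + 4 coprime. If d divides X (resp. X + 4), then X = da² and
-- X + 4 = b² (resp. X = b² and X + 4 = da²), and (b + a√d)/2 is a unit strictly between 1
-- and ε, contradicting minimality. Otherwise X + 4 = p b² with p ∈ {p₁, p₂} and b odd, so
-- X + 4 ≡ p ≡ 3 (mod 4), i.e. t ≡ 1 (mod 4).

module FermatLittle where

  open import Data.Nat
  open import Data.Nat.Properties
  open import Data.Nat.Divisibility
  open import Data.Nat.DivMod using (m≡m%n+[m/n]*n)
  open import Data.Nat.Primality using (Prime; euclidsLemma)
  open import Data.Nat.Coprimality using (coprime-divisor; prime⇒coprime)
  open import Data.Nat.Combinatorics using (_C_; nCk+nC[k+1]≡[n+1]C[k+1]; nC1≡n; nCn≡1)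
  open import Data.Nat.Tactic.RingSolver using (solve-∀)
  open import Data.Fin as Fin using (Fin; toℕ; inject₁; fromℕ)
  open import Data.Fin.Properties using (toℕ-inject₁; toℕ-fromℕ; toℕ<n)
  open import Data.Vec.Functional using (Vector; init; last; tail)
  open import Data.Product using (∃; _,_; proj₁; proj₂)
  open import Data.Sum using (inj₁; inj₂)
  open import Relation.Nullary using (¬_; contradiction)
  open import Relation.Binary.PropositionalEquality
  import Algebra.Properties.CommutativeSemiring.Binomial +-*-commutativeSemiring as Binomial
  import Algebra.Definitions.RawSemiring +-*-rawSemiring as Raw
  open import Algebra.Properties.Monoid.Sum +-0-monoid using (sum; sum-init-last)
  open ≡-Reasoning

  ×≡* : ∀ n x → n Raw.× x ≡ n * x
  ×≡* zero    x = refl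
  ×≡* (suc n) x = cong (x +_) (×≡* n x)

  ^≡^ : ∀ x n → x Raw.^ n ≡ x ^ n
  ^≡^ x zero    = refl
  ^≡^ x (suc n) = cong (x *_) (^≡^ x n)

  [1+k]*[1+n]C[1+k]≡[1+n]*nCk : ∀ n k → suc k * (suc n C suc k) ≡ suc n * (n C k)
  [1+k]*[1+n]C[1+k]≡[1+n]*nCk n zero =
    trans (*-identityˡ (suc n C 1)) (trans (nC1≡n (suc n)) (sym (*-identityʳ (suc n))))
  [1+k]*[1+n]C[1+k]≡[1+n]*nCk zero (suc k) = *-zeroʳ (suc (suc k))
  [1+k]*[1+n]C[1+k]≡[1+n]*nCk (suc n) (suc k) = begin
    suc (suc k) * (suc (suc n) C suc (suc k))
      ≡⟨ cong (suc (suc k) *_) (nCk+nC[k+1]≡[n+1]C[k+1] (suc n) (suc k)) ⟨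
    suc (suc k) * (X + Y)
      ≡⟨ distribute k X Y ⟩
    X + suc k * X + suc (suc k) * Y
      ≡⟨ cong₂ (λ l r → X + l + r) ([1+k]*[1+n]C[1+k]≡[1+n]*nCk n k)
                                   ([1+k]*[1+n]C[1+k]≡[1+n]*nCk n (suc k)) ⟩
    X + suc n * (n C k) + suc n * (n C suc k)
      ≡⟨ +-assoc X _ _ ⟩
    X + (suc n * (n C k) + suc n * (n C suc k))
      ≡⟨ cong (X +_) (*-distribˡ-+ (suc n) (n C k) _) ⟨
    X + suc n * (n C k + n C suc k)
      ≡⟨ cong (λ z → X + suc n * z) (nCk+nC[k+1]≡[n+1]C[k+1] n k) ⟩
    suc (suc n) * X
      ∎
    where
    X Y : ℕ
    X = suc n C suc k
    Y = suc n C suc (suc k)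
    distribute : ∀ k X Y → suc (suc k) * (X + Y) ≡ X + suc k * X + suc (suc k) * Y
    distribute = solve-∀

  p∣pCk : ∀ {p k} → Prime p → 0 < k → k < p → p ∣ p C k
  p∣pCk {suc q} {suc k} p-prime _ k<p =
    coprime-divisor (prime⇒coprime p-prime k<p)
      (divides (q C k) (trans ([1+k]*[1+n]C[1+k]≡[1+n]*nCk q k) (*-comm (suc q) (q C k))))

  ∣-sum : ∀ {d n} (t : Vector ℕ n) → (∀ i → d ∣ t i) → d ∣ sum t
  ∣-sum {d} {zero}  t _   = d ∣0
  ∣-sum {n = suc n} t d∣t = ∣m∣n⇒∣m+n (d∣t Fin.zero) (∣-sum (tail t) (λ i → d∣t (Fin.suc i)))

  binomialTerm-≡ : ∀ n a (k : Fin (suc n)) → Binomial.binomialTerm a 1 n k ≡ (n C toℕ k) * a ^ toℕ k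
  binomialTerm-≡ n a k = begin
    (n C toℕ k) Raw.× (a Raw.^ toℕ k * 1 Raw.^ (n ∸ toℕ k))
      ≡⟨ ×≡* (n C toℕ k) _ ⟩
    (n C toℕ k) * (a Raw.^ toℕ k * 1 Raw.^ (n ∸ toℕ k))
      ≡⟨ cong₂ (λ x y → (n C toℕ k) * (x * y)) (^≡^ a (toℕ k)) (trans (^≡^ 1 (n ∸ toℕ k)) (^-zeroˡ (n ∸ toℕ k))) ⟩
    (n C toℕ k) * (a ^ toℕ k * 1)
      ≡⟨ cong ((n C toℕ k) *_) (*-identityʳ (a ^ toℕ k)) ⟩
    (n C toℕ k) * a ^ toℕ k
      ∎

  freshman's-dream : ∀ {p} → Prime p → ∀ a → ∃ λ M → suc a ^ p ≡ 1 + M * p + a ^ p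
  freshman's-dream {p@(suc q)} p-prime a = quotient p∣middle , (begin
    suc a ^ p                                  ≡⟨ ^≡^ (suc a) p ⟨
    suc a Raw.^ p                              ≡⟨ cong (Raw._^ p) (+-comm 1 a) ⟩
    (a + 1) Raw.^ p                            ≡⟨ Binomial.theorem p a 1 ⟩
    sum t                                      ≡⟨ cong (t Fin.zero +_) (sum-init-last (tail t)) ⟩
    t Fin.zero + (sum middle + last (tail t))  ≡⟨ cong₂ (λ x y → x + (sum middle + y)) first final ⟩
    1 + (sum middle + a ^ p)                   ≡⟨ cong (λ z → 1 + (z + a ^ p)) (_∣_.equality p∣middle) ⟩
    1 + (quotient p∣middle * p + a ^ p)        ≡⟨ +-assoc 1 (quotient p∣middle * p) (a ^ p) ⟨
    1 + quotient p∣middle * p + a ^ p          ∎)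
    where
    t : Vector ℕ (suc p)
    t = Binomial.binomialTerm a 1 p
    middle : Vector ℕ q
    middle = init (tail t)
    first : t Fin.zero ≡ 1
    first = binomialTerm-≡ p a Fin.zero
    final : last (tail t) ≡ a ^ p
    final = begin
      last (tail t)                                  ≡⟨ binomialTerm-≡ p a (Fin.suc (fromℕ q)) ⟩
      (p C suc (toℕ (fromℕ q))) * a ^ suc (toℕ (fromℕ q)) ≡⟨ cong (λ k → (p C suc k) * a ^ suc k) (toℕ-fromℕ q) ⟩
      (p C p) * a ^ p                                ≡⟨ cong (_* a ^ p) (nCn≡1 p) ⟩
      1 * a ^ p                                      ≡⟨ *-identityˡ (a ^ p) ⟩
      a ^ p                                          ∎
    p∣middle : p ∣ sum middle
    p∣middle = ∣-sum middle λ i →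
      subst (p ∣_) (sym (binomialTerm-≡ p a (Fin.suc (inject₁ i))))
        (subst (λ k → p ∣ (p C suc k) * a ^ suc k) (sym (toℕ-inject₁ i))
          (∣m⇒∣m*n (a ^ suc (toℕ i)) (p∣pCk p-prime z<s (s<s (toℕ<n i)))))

  -- Opaque: unfolding the binomial expansion during later conversion checks is prohibitively slow.
  opaque
    fermat : ∀ {p} → Prime p → ∀ a → ∃ λ N → a ^ p ≡ a + N * p
    fermat {suc q} p-prime zero    = 0 , refl
    fermat {p}     p-prime (suc a) with freshman's-dream p-prime a | fermat p-prime a
    ... | M , dream | N , ih = N + M , (begin
      suc a ^ p                  ≡⟨ dream ⟩
      1 + M * p + a ^ p          ≡⟨ cong (1 + M * p +_) ih ⟩
      1 + M * p + (a + N * p)    ≡⟨ regroup M N a p ⟩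
      suc a + (N + M) * p        ∎)
      where
      regroup : ∀ M N a p → 1 + M * p + (a + N * p) ≡ suc a + (N + M) * p
      regroup = solve-∀

  fermat-little : ∀ {p a} → Prime p → ¬ p ∣ a → ∃ λ c → a ^ (p ∸ 1) ≡ 1 + c * p
  fermat-little {p} {zero} _ p∤0 = contradiction (p ∣0) p∤0
  fermat-little {p@(suc q)} {a@(suc _)} p-prime p∤a with fermat p-prime a
  ... | N , a^p≡a+N*p = quotient p∣r , trans a^q≡1+r (cong (1 +_) (_∣_.equality p∣r))
    where
    r : ℕ
    r = a ^ q ∸ 1
    a^q≡1+r : a ^ q ≡ 1 + r
    a^q≡1+r = sym (m+[n∸m]≡n (m^n>0 a q))
    a*r≡N*p : a * r ≡ N * p
    a*r≡N*p = +-cancelˡ-≡ a _ _ (begin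
      a + a * r     ≡⟨ *-suc a r ⟨
      a * (1 + r)   ≡⟨ cong (a *_) a^q≡1+r ⟨
      a ^ p         ≡⟨ a^p≡a+N*p ⟩
      a + N * p     ∎)
    p∣r : p ∣ r
    p∣r with euclidsLemma a r p-prime (divides N a*r≡N*p)
    ... | inj₁ p∣a = contradiction p∣a p∤a
    ... | inj₂ p∣r = p∣r

  x+y∣x^[1+2k]+y^[1+2k] : ∀ x y k → x + y ∣ x ^ (1 + k * 2) + y ^ (1 + k * 2)
  x+y∣x^[1+2k]+y^[1+2k] x y zero = divides 1 (base x y)
    where
    base : ∀ x y → x * 1 + y * 1 ≡ 1 * (x + y)
    base = solve-∀
  x+y∣x^[1+2k]+y^[1+2k] x y (suc k) =
    ∣m+n∣m⇒∣n (divides (x ^ suc n + y ^ suc n) (step x y (x ^ n) (y ^ n)))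
              (∣n⇒∣m*n (x * y) (x+y∣x^[1+2k]+y^[1+2k] x y k))
    where
    n : ℕ
    n = 1 + k * 2
    step : ∀ x y xⁿ yⁿ → x * y * (xⁿ + yⁿ) + (x * (x * xⁿ) + y * (y * yⁿ)) ≡ (x * xⁿ + y * yⁿ) * (x + y)
    step = solve-∀

  -- (p − 1)/2 is odd, so x² + 4 divides x^(p−1) + 2^(p−1), which is 2 modulo p.
  p∤x²+4 : ∀ {p} → Prime p → p % 4 ≡ 3 → ∀ x → ¬ p ∣ x * x + 4
  p∤x²+4 {p} p-prime p%4≡3 x p∣x²+4 = p∤2 (∣m+n∣m⇒∣n p∣[c₁+c₂]p+2 (n∣m*n (c₁ + c₂)))
    where
    k m : ℕ
    k = p / 4
    m = 1 + k * 2
    p≡3+4k : p ≡ 3 + k * 4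
    p≡3+4k = trans (m≡m%n+[m/n]*n p 4) (cong (_+ k * 4) p%4≡3)
    p∤2 : ¬ p ∣ 2
    p∤2 p∣2 = <⇒≱ (subst (2 <_) (sym p≡3+4k) (m≤m+n 3 (k * 4))) (∣⇒≤ p∣2)
    p∤x : ¬ p ∣ x
    p∤x p∣x with euclidsLemma 2 2 p-prime (∣m+n∣m⇒∣n p∣x²+4 (∣m⇒∣m*n x p∣x))
    ... | inj₁ p∣2 = p∤2 p∣2
    ... | inj₂ p∣2 = p∤2 p∣2
    ^[p∸1]≡[y²]^m : ∀ y → y ^ (p ∸ 1) ≡ (y * y) ^ m
    ^[p∸1]≡[y²]^m y = begin
      y ^ (p ∸ 1)              ≡⟨ cong (λ n → y ^ (n ∸ 1)) p≡3+4k ⟩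
      y ^ (2 + k * 4)          ≡⟨ cong (y ^_) (halve k) ⟩
      y ^ (2 * m)              ≡⟨ ^-*-assoc y 2 m ⟨
      (y ^ 2) ^ m              ≡⟨ cong (λ z → (y * z) ^ m) (*-identityʳ y) ⟩
      (y * y) ^ m              ∎
      where
      halve : ∀ k → 2 + k * 4 ≡ 2 * (1 + k * 2)
      halve = solve-∀
    c₁ c₂ : ℕ
    c₁ = proj₁ (fermat-little p-prime p∤x)
    c₂ = proj₁ (fermat-little p-prime p∤2)
    sum≡ : (x * x) ^ m + 4 ^ m ≡ (c₁ + c₂) * p + 2
    sum≡ = begin
      (x * x) ^ m + 4 ^ m              ≡⟨ cong₂ _+_ (^[p∸1]≡[y²]^m x) (^[p∸1]≡[y²]^m 2) ⟨
      x ^ (p ∸ 1) + 2 ^ (p ∸ 1)        ≡⟨ cong₂ _+_ (proj₂ (fermat-little p-prime p∤x)) (proj₂ (fermat-little p-prime p∤2)) ⟩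
      1 + c₁ * p + (1 + c₂ * p)        ≡⟨ regroup c₁ c₂ p ⟩
      (c₁ + c₂) * p + 2                ∎
      where
      regroup : ∀ c₁ c₂ p → 1 + c₁ * p + (1 + c₂ * p) ≡ (c₁ + c₂) * p + 2
      regroup = solve-∀
    p∣[c₁+c₂]p+2 : p ∣ (c₁ + c₂) * p + 2
    p∣[c₁+c₂]p+2 = subst (p ∣_) sum≡ (∣-trans p∣x²+4 (x+y∣x^[1+2k]+y^[1+2k] (x * x) 4 k))

module OddNumbers where

  open import Data.Nat
  open import Data.Nat.Properties
  open import Data.Nat.Divisibility
  open import Data.Nat.DivMod using (_%_; m≡m%n+[m/n]*n; [m+kn]%n≡m%n; [m+n]%n≡m%n; %-distribˡ-*; %-distribˡ-+; m%n<n)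
  open import Data.Nat.Primality using (prime[2]; prime⇒irreducible)
  open import Data.Nat.Coprimality using (Coprime; coprime-divisor)
  open import Data.Nat.Tactic.RingSolver using (solve-∀)
  open import Data.Product using (∃; _,_)
  open import Data.Sum using (inj₁; inj₂)
  open import Relation.Nullary using (¬_; contradiction)
  open import Relation.Binary.PropositionalEquality
  open ≡-Reasoning

  Odd : ℕ → Set
  Odd n = ∃ λ k → n ≡ 1 + 2 * k

  odd⇒¬2∣ : ∀ {n} → Odd n → ¬ 2 ∣ n
  odd⇒¬2∣ (k , refl) 2∣n with ∣1⇒≡1 (∣m+n∣m⇒∣n (subst (2 ∣_) (+-comm 1 (2 * k)) 2∣n) (m∣m*n k))
  ... | ()

  ¬2∣⇒odd : ∀ {n} → ¬ 2 ∣ n → Odd n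
  ¬2∣⇒odd {n} 2∤n with n % 2 | m%n<n n 2 | m≡m%n+[m/n]*n n 2
  ... | 0 | _ | n≡[n/2]*2 = contradiction (divides (n / 2) n≡[n/2]*2) 2∤n
  ... | 1 | _ | n≡1+[n/2]*2 = n / 2 , trans n≡1+[n/2]*2 (cong suc (*-comm (n / 2) 2))
  ... | suc (suc _) | s≤s (s≤s ()) | _

  odd⇒n>0 : ∀ {n} → Odd n → 0 < n
  odd⇒n>0 (_ , refl) = z<s

  2∣1+n⇒odd : ∀ {n} → 2 ∣ suc n → Odd n
  2∣1+n⇒odd (divides (suc q) 1+n≡[1+q]*2) = q , trans (suc-injective 1+n≡[1+q]*2) (cong suc (*-comm q 2))

  odd-*ˡ : ∀ {m n} → Odd (m * n) → Odd m
  odd-*ˡ {n = n} odd = ¬2∣⇒odd (λ 2∣m → odd⇒¬2∣ odd (∣m⇒∣m*n n 2∣m))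

  odd-*ʳ : ∀ {m n} → Odd (m * n) → Odd n
  odd-*ʳ {m} odd = ¬2∣⇒odd (λ 2∣n → odd⇒¬2∣ odd (∣n⇒∣m*n m 2∣n))

  odd-+4 : ∀ {n} → Odd n → Odd (n + 4)
  odd-+4 (k , refl) = k + 2 , shift k
    where
    shift : ∀ k → 1 + 2 * k + 4 ≡ 1 + 2 * (k + 2)
    shift = solve-∀

  odd⇒coprime[n,n+4] : ∀ {n} → Odd n → Coprime n (n + 4)
  odd⇒coprime[n,n+4] {n} odd {i} (i∣n , i∣n+4) = coprime[2,n] (i∣2 , i∣n)
    where
    coprime[2,n] : Coprime 2 n
    coprime[2,n] {j} (j∣2 , j∣n) with prime⇒irreducible prime[2] j∣2
    ... | inj₁ j≡1  = j≡1
    ... | inj₂ refl = contradiction j∣n (odd⇒¬2∣ odd)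
    i∣2 : i ∣ 2
    i∣2 = coprime-divisor (λ (j∣i , j∣2) → coprime[2,n] (j∣2 , ∣-trans j∣i i∣n)) (∣m+n∣m⇒∣n i∣n+4 i∣n)

  odd²%4≡1 : ∀ {b} → Odd b → (b * b) % 4 ≡ 1
  odd²%4≡1 (c , refl) = trans (cong (_% 4) (square c)) ([m+kn]%n≡m%n 1 (c + c * c) 4)
    where
    square : ∀ c → (1 + 2 * c) * (1 + 2 * c) ≡ 1 + (c + c * c) * 4
    square = solve-∀

  n+4≡pb²⇒4∣n+1 : ∀ {p b n} → p % 4 ≡ 3 → Odd b → n + 4 ≡ p * (b * b) → 4 ∣ n + 1
  n+4≡pb²⇒4∣n+1 {p} {b} {n} p%4≡3 odd n+4≡pb² = m%n≡0⇒n∣m (n + 1) 4 (begin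
    (n + 1) % 4                   ≡⟨ %-distribˡ-+ n 1 4 ⟩
    (n % 4 + 1) % 4               ≡⟨ cong (λ r → (r + 1) % 4) n%4≡3 ⟩
    0                             ∎)
    where
    n%4≡3 : n % 4 ≡ 3
    n%4≡3 = begin
      n % 4                       ≡⟨ [m+n]%n≡m%n n 4 ⟨
      (n + 4) % 4                 ≡⟨ cong (_% 4) n+4≡pb² ⟩
      (p * (b * b)) % 4           ≡⟨ %-distribˡ-* p (b * b) 4 ⟩
      (p % 4 * ((b * b) % 4)) % 4 ≡⟨ cong₂ (λ r s → (r * s) % 4) p%4≡3 (odd²%4≡1 odd) ⟩
      3                           ∎

module CoprimeSquares where

  open import Data.Nat
  open import Data.Nat.Properties
  open import Data.Nat.Divisibility
  open import Data.Nat.DivMod using (_/_; m/n*n≡m)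
  open import Data.Nat.GCD using (gcd; gcd[m,n]∣m; gcd[m,n]∣n; gcd[m,n]≡0⇒n≡0)
  open import Data.Nat.Coprimality using (Coprime; coprime-divisor; coprime-/gcd)
  import Data.Nat.Coprimality as Coprimality
  open import Data.Nat.Primality using (Prime; prime⇒irreducible; ¬prime[1])
  open import Data.Nat.Tactic.RingSolver using (solve-∀)
  open import Data.Product using (∃; ∃₂; _,_; _×_; proj₁; proj₂)
  open import Function using (_∘_)
  open import Data.Sum using (inj₁; inj₂)
  open import Relation.Nullary using (contradiction)
  open import Relation.Binary.Definitions using (tri<; tri≈; tri>)
  open import Relation.Nullary.Decidable using (yes; no)
  open import Relation.Binary.PropositionalEquality
  open ≡-Reasoning

  m*m≡n*n⇒m≡n : ∀ {m n} → m * m ≡ n * n → m ≡ n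
  m*m≡n*n⇒m≡n {m} {n} eq with <-cmp m n
  ... | tri< m<n _ _ = contradiction eq (<⇒≢ (*-mono-< m<n m<n))
  ... | tri≈ _ m≡n _ = m≡n
  ... | tri> _ _ n<m = contradiction (sym eq) (<⇒≢ (*-mono-< n<m n<m))

  m*m<n*n⇒m<n : ∀ {m n} → m * m < n * n → m < n
  m*m<n*n⇒m<n {m} {n} m²<n² with m <? n
  ... | yes m<n = m<n
  ... | no m≮n  = contradiction (*-mono-≤ (≮⇒≥ m≮n) (≮⇒≥ m≮n)) (<⇒≱ m²<n²)

  coprime-∣ : ∀ {m n m′ n′} → m′ ∣ m → n′ ∣ n → Coprime m n → Coprime m′ n′
  coprime-∣ m′∣m n′∣n coprime (i∣m′ , i∣n′) = coprime (∣-trans i∣m′ m′∣m , ∣-trans i∣n′ n′∣n)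

  coprime∧square⇒square : ∀ {m n k} → Coprime m n → m * n ≡ k * k → ∃ λ a → m ≡ a * a
  coprime∧square⇒square {m} {n} {zero} coprime mn≡0 with m*n≡0⇒m≡0∨n≡0 m mn≡0
  ... | inj₁ m≡0  = 0 , m≡0
  ... | inj₂ refl = 1 , coprime (∣-refl , m ∣0)
  coprime∧square⇒square {m} {n} {k@(suc _)} coprime mn≡k² = g , (begin
    m          ≡⟨ m/n*n≡m (gcd[m,n]∣m m k) ⟨
    m′ * g     ≡⟨ cong (_* g) (∣-antisym m′∣g g∣m′) ⟩
    g * g      ∎)
    where
    g : ℕ
    g = gcd m k
    instance
      g≢0 : NonZero g
      g≢0 = ≢-nonZero (λ g≡0 → 1+n≢0 (gcd[m,n]≡0⇒n≡0 m g≡0))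
    m′ k′ : ℕ
    m′ = m / g
    k′ = k / g
    m′n≡gk′² : m′ * n ≡ g * (k′ * k′)
    m′n≡gk′² = *-cancelˡ-≡ _ _ g (begin
      g * (m′ * n)              ≡⟨ regroup g m′ n ⟩
      m′ * g * n                ≡⟨ cong (_* n) (m/n*n≡m (gcd[m,n]∣m m k)) ⟩
      m * n                     ≡⟨ mn≡k² ⟩
      k * k                     ≡⟨ cong₂ _*_ (m/n*n≡m (gcd[m,n]∣n m k)) (m/n*n≡m (gcd[m,n]∣n m k)) ⟨
      k′ * g * (k′ * g)         ≡⟨ regroup′ g k′ ⟩
      g * (g * (k′ * k′))       ∎)
      where
      regroup : ∀ g m′ n → g * (m′ * n) ≡ m′ * g * n
      regroup = solve-∀
      regroup′ : ∀ g k′ → k′ * g * (k′ * g) ≡ g * (g * (k′ * k′))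
      regroup′ = solve-∀
    m′∣g : m′ ∣ g
    m′∣g = coprime-divisor (coprime-/gcd m k) (coprime-divisor (coprime-/gcd m k)
             (divides n (trans (regroup g k′) (trans (sym m′n≡gk′²) (*-comm m′ n)))))
      where
      regroup : ∀ g k′ → k′ * (k′ * g) ≡ g * (k′ * k′)
      regroup = solve-∀
    g∣m′ : g ∣ m′
    g∣m′ = coprime-divisor (coprime-∣ (gcd[m,n]∣m m k) ∣-refl coprime)
             (divides (k′ * k′) (trans (*-comm n m′) (trans m′n≡gk′² (*-comm g _))))

  coprime-split : ∀ {A B m n k} .{{_ : NonZero (m * n)}} → Coprime A B → m ∣ A → n ∣ B →
                  A * B ≡ m * n * (k * k) →
                  ∃₂ λ a b → A ≡ m * (a * a) × B ≡ n * (b * b) × k ≡ a * b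
  coprime-split {A} {B} {m} {n} {k} coprime (divides A′ A≡A′m) (divides B′ B≡B′n) AB≡mnk² =
    a , b , trans A≡A′m (trans (cong (_* m) A′≡a²) (*-comm _ m)) ,
            trans B≡B′n (trans (cong (_* n) B′≡b²) (*-comm _ n)) ,
            m*m≡n*n⇒m≡n k²≡[ab]²
    where
    A′B′≡k² : A′ * B′ ≡ k * k
    A′B′≡k² = *-cancelˡ-≡ _ _ (m * n) (begin
      m * n * (A′ * B′)    ≡⟨ regroup m n A′ B′ ⟩
      A′ * m * (B′ * n)    ≡⟨ cong₂ _*_ A≡A′m B≡B′n ⟨
      A * B                ≡⟨ AB≡mnk² ⟩
      m * n * (k * k)      ∎)
      where
      regroup : ∀ m n A′ B′ → m * n * (A′ * B′) ≡ A′ * m * (B′ * n)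
      regroup = solve-∀
    coprime′ : Coprime A′ B′
    coprime′ = coprime-∣ (subst (A′ ∣_) (sym A≡A′m) (m∣m*n m)) (subst (B′ ∣_) (sym B≡B′n) (m∣m*n n)) coprime
    A′-square : ∃ λ a → A′ ≡ a * a
    A′-square = coprime∧square⇒square {k = k} coprime′ A′B′≡k²
    B′-square : ∃ λ b → B′ ≡ b * b
    B′-square = coprime∧square⇒square {k = k} (Coprimality.sym coprime′) (trans (*-comm B′ A′) A′B′≡k²)
    a b : ℕ
    a = proj₁ A′-square
    b = proj₁ B′-square
    A′≡a² : A′ ≡ a * a
    A′≡a² = proj₂ A′-square
    B′≡b² : B′ ≡ b * b
    B′≡b² = proj₂ B′-square
    k²≡[ab]² : k * k ≡ a * b * (a * b)
    k²≡[ab]² = begin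
      k * k                ≡⟨ A′B′≡k² ⟨
      A′ * B′              ≡⟨ cong₂ _*_ A′≡a² B′≡b² ⟩
      a * a * (b * b)      ≡⟨ regroup a b ⟩
      a * b * (a * b)      ∎
      where
      regroup : ∀ a b → a * a * (b * b) ≡ a * b * (a * b)
      regroup = solve-∀

  distinct-primes⇒coprime : ∀ {p q} → Prime p → Prime q → p ≢ q → Coprime p q
  distinct-primes⇒coprime p-prime q-prime p≢q {i} (i∣p , i∣q) with prime⇒irreducible p-prime i∣p
  ... | inj₁ i≡1 = i≡1
  ... | inj₂ refl with prime⇒irreducible q-prime i∣q
  ...   | inj₁ refl = contradiction p-prime ¬prime[1]
  ...   | inj₂ p≡q  = contradiction p≡q p≢q

  p∣n∧q∣n⇒pq∣n : ∀ {p q n} → Prime p → Prime q → p ≢ q → p ∣ n → q ∣ n → p * q ∣ n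
  p∣n∧q∣n⇒pq∣n {p} {q} {n} p-prime q-prime p≢q (divides x n≡xp) q∣n = divides y (begin
    n              ≡⟨ n≡xp ⟩
    x * p          ≡⟨ cong (_* p) x≡yq ⟩
    y * q * p      ≡⟨ regroup y q p ⟩
    y * (p * q)    ∎)
    where
    q∣x : q ∣ x
    q∣x = coprime-divisor (distinct-primes⇒coprime q-prime p-prime (p≢q ∘ sym))
            (subst (q ∣_) (trans n≡xp (*-comm x p)) q∣n)
    y : ℕ
    y = quotient q∣x
    x≡yq : x ≡ y * q
    x≡yq = _∣_.equality q∣x
    regroup : ∀ y q p → y * q * p ≡ y * (p * q)
    regroup = solve-∀

module QuadraticUnits where

  open import Defs
  open import Data.Nat
  open import Data.Nat.Properties
  open import Data.Nat.Divisibility using (divides)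
  open import Data.Integer as ℤ using (+_; -_; 0ℤ; ∣_∣; +≤+)
  open import Data.Integer.Properties
    using (pos-+; pos-*; abs-*; drop‿+≤+; 0≤i-j⇒j≤i; ⊖-≥; [+m]-[+n]≡m⊖n)
  import Data.Integer.Properties as ℤ
  open import Data.Integer.Tactic.RingSolver using (solve-∀)
  open import Data.Product using (_,_)
  open import Data.Sum using (inj₁; inj₂)
  open import Data.Empty using (⊥)
  open import Relation.Nullary using (¬_; contradiction)
  open import Relation.Binary.PropositionalEquality
  open ≡-Reasoning
  open OddNumbers using (Odd; odd⇒n>0)

  data Norm±4 (d b a : ℕ) : Set where
    norm+4 : b * b ≡ d * (a * a) + 4 → Norm±4 d b a
    norm-4 : b * b + 4 ≡ d * (a * a) → Norm±4 d b a

  +m-+n≡+k⇒m≡n+k : ∀ {m n k} → + m ℤ.- + n ≡ + k → m ≡ n + k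
  +m-+n≡+k⇒m≡n+k {m} {n} {k} eq = ℤ.+-injective (begin
    + m                      ≡⟨ cancel (+ m) (+ n) ⟩
    + n ℤ.+ (+ m ℤ.- + n)    ≡⟨ cong (λ z → + n ℤ.+ z) eq ⟩
    + n ℤ.+ + k              ≡⟨ pos-+ n k ⟨
    + (n + k)                ∎)
    where
    cancel : ∀ i j → i ≡ j ℤ.+ (i ℤ.- j)
    cancel = solve-∀

  m≡n+k⇒+m-+n≡+k : ∀ {m n k} → m ≡ n + k → + m ℤ.- + n ≡ + k
  m≡n+k⇒+m-+n≡+k {n = n} {k} refl = begin
    + (n + k) ℤ.- + n        ≡⟨ cong (ℤ._- + n) (pos-+ n k) ⟩
    + n ℤ.+ + k ℤ.- + n      ≡⟨ cancel (+ n) (+ k) ⟩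
    + k                      ∎
    where
    cancel : ∀ i j → i ℤ.+ j ℤ.- i ≡ j
    cancel = solve-∀

  swap-difference : ∀ i j → - (i ℤ.- j) ≡ j ℤ.- i
  swap-difference = solve-∀

  norm-≡ : ∀ d b a → + b ℤ.* + b ℤ.- + d ℤ.* (+ a ℤ.* + a) ≡ + (b * b) ℤ.- + (d * (a * a))
  norm-≡ d b a = sym (cong₂ ℤ._-_ (pos-* b b) (trans (pos-* d (a * a)) (cong (λ z → + d ℤ.* z) (pos-* a a))))

  unit⇒norm±4 : ∀ {d T U} → IsUnitO (+ d) (+ T) (+ U) → Norm±4 d T U
  unit⇒norm±4 {d} {T} {U} (_ , inj₁ N≡4) =
    norm+4 (+m-+n≡+k⇒m≡n+k (trans (sym (norm-≡ d T U)) N≡4))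
  unit⇒norm±4 {d} {T} {U} (_ , inj₂ N≡-4) =
    norm-4 (sym (+m-+n≡+k⇒m≡n+k (trans (sym (swap-difference (+ (T * T)) (+ (d * (U * U)))))
                                        (cong -_ (trans (sym (norm-≡ d T U)) N≡-4)))))

  odd≡odd[mod2] : ∀ {b a} → Odd b → Odd a → (+ b) ≡ (+ a) [mod (+ 2) ]
  odd≡odd[mod2] (c , refl) (e , refl) = divides ∣ + c ℤ.- + e ∣ (begin
    ∣ + (1 + 2 * c) ℤ.- + (1 + 2 * e) ∣     ≡⟨ cong ∣_∣ (cong₂ ℤ._-_ (pos-odd c) (pos-odd e)) ⟩
    ∣ + 1 ℤ.+ + 2 ℤ.* + c ℤ.- (+ 1 ℤ.+ + 2 ℤ.* + e) ∣ ≡⟨ cong ∣_∣ (factor (+ c) (+ e)) ⟩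
    ∣ + 2 ℤ.* (+ c ℤ.- + e) ∣                ≡⟨ abs-* (+ 2) (+ c ℤ.- + e) ⟩
    2 * ∣ + c ℤ.- + e ∣                      ≡⟨ *-comm 2 ∣ + c ℤ.- + e ∣ ⟩
    ∣ + c ℤ.- + e ∣ * 2                      ∎)
    where
    pos-odd : ∀ c → + (1 + 2 * c) ≡ + 1 ℤ.+ + 2 ℤ.* + c
    pos-odd c = trans (pos-+ 1 (2 * c)) (cong (λ z → + 1 ℤ.+ z) (pos-* 2 c))
    factor : ∀ c e → + 1 ℤ.+ + 2 ℤ.* c ℤ.- (+ 1 ℤ.+ + 2 ℤ.* e) ≡ + 2 ℤ.* (c ℤ.- e)
    factor = solve-∀

  odd-norm±4⇒unit : ∀ {d b a} → Odd b → Odd a → Norm±4 d b a → IsUnitO (+ d) (+ b) (+ a)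
  odd-norm±4⇒unit {d} {b} {a} odd-b odd-a (norm+4 eq) =
    odd≡odd[mod2] odd-b odd-a , inj₁ (trans (norm-≡ d b a) (m≡n+k⇒+m-+n≡+k eq))
  odd-norm±4⇒unit {d} {b} {a} odd-b odd-a (norm-4 eq) =
    odd≡odd[mod2] odd-b odd-a ,
    inj₂ (trans (norm-≡ d b a) (trans (sym (swap-difference (+ (d * (a * a))) (+ (b * b))))
                                      (cong -_ (m≡n+k⇒+m-+n≡+k (sym eq)))))

  unit>1 : ∀ {d b a} → 1 ≤ b → 2 ≤ d * (a * a) → LtQ (+ d) (+ 2) 0ℤ (+ b) (+ a)
  unit>1 {d} {a = zero} _ 2≤d*0 _ = contradiction (subst (2 ≤_) (*-zeroʳ d) 2≤d*0) λ ()
  unit>1 {a = suc _} _ _ (inj₁ (() , _))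
  unit>1 {d} {suc zero} {a@(suc _)} _ 2≤da² (inj₂ (_ , _ , da²≤1)) =
    <⇒≱ 2≤da² (drop‿+≤+ (subst (ℤ._≤ + 1) (sym (pos-* d (a * a))) da²≤1))
  unit>1 {d} {suc (suc zero)} {a@(suc _)} _ 2≤da² (inj₂ (_ , _ , da²≤0)) =
    <⇒≱ 2≤da² (m≤n⇒m≤1+n (drop‿+≤+ (subst (ℤ._≤ 0ℤ) (sym (pos-* d (a * a))) da²≤0)))
  unit>1 {b = suc (suc (suc _))} {suc _} _ _ (inj₂ (_ , +≤+ () , _))

  b<T∧a≤U⇒LtQ : ∀ {d T U b a} → b < T → a ≤ U → LtQ (+ d) (+ b) (+ a) (+ T) (+ U)
  b<T∧a≤U⇒LtQ {d} {T} {U} {b} {a} b<T a≤U = refute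
    where
    X≡T∸b : + T ℤ.- + b ≡ + (T ∸ b)
    X≡T∸b = trans ([+m]-[+n]≡m⊖n T b) (⊖-≥ (<⇒≤ b<T))
    X≰0 : ¬ (+ T ℤ.- + b) ℤ.≤ 0ℤ
    X≰0 X≤0 = <⇒≱ (m<n⇒0<n∸m b<T) (drop‿+≤+ (subst (ℤ._≤ 0ℤ) X≡T∸b X≤0))
    Y≡0 : 0ℤ ℤ.≤ + a ℤ.- + U → + a ℤ.- + U ≡ 0ℤ
    Y≡0 0≤Y rewrite ≤-antisym a≤U (drop‿+≤+ (0≤i-j⇒j≤i 0≤Y)) = ℤ.+-inverseʳ (+ U)
    refute : ¬ LeQ (+ d) (+ T) (+ U) (+ b) (+ a)
    refute (inj₁ (_ , inj₁ X≤0))     = X≰0 X≤0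
    refute (inj₂ (_ , X≤0 , _))      = X≰0 X≤0
    refute (inj₁ (0≤Y , inj₂ X²≤dY²)) = <⇒≱ (*-mono-< 0<T∸b 0<T∸b) (drop‿+≤+ (subst₂ ℤ._≤_ X²≡ dY²≡0 X²≤dY²))
      where
      0<T∸b : 0 < T ∸ b
      0<T∸b = m<n⇒0<n∸m b<T
      X²≡ : (+ T ℤ.- + b) ℤ.* (+ T ℤ.- + b) ≡ + ((T ∸ b) * (T ∸ b))
      X²≡ = trans (cong₂ ℤ._*_ X≡T∸b X≡T∸b) (sym (pos-* (T ∸ b) (T ∸ b)))
      dY²≡0 : + d ℤ.* ((+ a ℤ.- + U) ℤ.* (+ a ℤ.- + U)) ≡ 0ℤ
      dY²≡0 = trans (cong (λ y → + d ℤ.* (y ℤ.* y)) (Y≡0 0≤Y)) (ℤ.*-zeroʳ (+ d))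

  ¬smaller-unit : ∀ {d T U b a} → IsFundamentalUnit (+ d) (+ T) (+ U) →
                  Odd b → Odd a → Norm±4 d b a → 2 ≤ d * (a * a) → b < T → a ≤ U → ⊥
  ¬smaller-unit {d} {b = b} {a} (_ , _ , least) odd-b odd-a norm 2≤da² b<T a≤U =
    b<T∧a≤U⇒LtQ {d} b<T a≤U (least (+ b) (+ a) unit (unit>1 {d} {b} {a} (odd⇒n>0 odd-b) 2≤da²))
    where
    unit : IsUnitO (+ d) (+ b) (+ a)
    unit = odd-norm±4⇒unit odd-b odd-a norm

module FundamentalUnit where

  open import Defs
  open import Data.Nat
  open import Data.Nat.Properties
  open import Data.Nat.Divisibility
  open import Data.Nat.Primality using (Prime; euclidsLemma; prime⇒nonZero; prime⇒nonTrivial)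
  open import Data.Nat.Coprimality using (Coprime)
  open import Data.Nat.Tactic.RingSolver using (solve-∀)
  open import Data.Integer using (+_)
  open import Data.Product using (∃₂; _×_; _,_)
  open import Data.Sum using (inj₁; inj₂)
  open import Data.Empty using (⊥; ⊥-elim)
  open import Relation.Binary.PropositionalEquality
  open OddNumbers
  open CoprimeSquares using (m*m<n*n⇒m<n; coprime-split; p∣n∧q∣n⇒pq∣n)
  open QuadraticUnits

  X+4<[2+X]² : ∀ X → 0 < X → X + 4 < (2 + X) * (2 + X)
  X+4<[2+X]² (suc Y) _ = subst (suc Y + 4 <_) (sym (expand Y)) (m<m+n (suc Y + 4) z<s)
    where
    expand : ∀ Y → (2 + suc Y) * (2 + suc Y) ≡ suc Y + 4 + suc (Y * Y + 5 * Y + 3)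
    expand = solve-∀

  split⇒4∣n+1 : ∀ {p q n k} .{{_ : NonZero (p * q)}} → q % 4 ≡ 3 → Odd n → p ∣ n → q ∣ n + 4 →
                n * (n + 4) ≡ p * q * (k * k) → 4 ∣ n + 1
  split⇒4∣n+1 {p} {q} {n} {k} q%4≡3 odd-n p∣n q∣n+4 eq =
    let (_ , b , _ , n+4≡qb² , _) = coprime-split {k = k} (odd⇒coprime[n,n+4] odd-n) p∣n q∣n+4 eq
    in n+4≡pb²⇒4∣n+1 {q} {b} q%4≡3 (odd-*ˡ {b} {b} (odd-*ʳ {q} (subst Odd n+4≡qb² (odd-+4 odd-n)))) n+4≡qb²

  module _ {p₁ p₂ X U : ℕ} (p₁-prime : Prime p₁) (p₂-prime : Prime p₂)
           (fundamental : IsFundamentalUnit (+ (p₁ * p₂)) (+ (2 + X)) (+ U))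
           (odd-X : Odd X) (X[X+4]≡dU² : X * (X + 4) ≡ p₁ * p₂ * (U * U)) where

    d : ℕ
    d = p₁ * p₂

    instance
      d≢0 : NonZero d
      d≢0 = m*n≢0 p₁ p₂ {{prime⇒nonZero p₁-prime}} {{prime⇒nonZero p₂-prime}}

    coprime : Coprime X (X + 4)
    coprime = odd⇒coprime[n,n+4] odd-X

    d∣X⇒⊥ : d ∣ X → ⊥
    d∣X⇒⊥ d∣X = refute (coprime-split {m = d} {n = 1} {k = U} {{m*n≢0 d 1}} coprime d∣X (1∣ (X + 4))
                           (trans X[X+4]≡dU² (cong (_* (U * U)) (sym (*-identityʳ d)))))
      where
      refute : (∃₂ λ a b → X ≡ d * (a * a) × X + 4 ≡ 1 * (b * b) × U ≡ a * b) → ⊥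
      refute (a , b , X≡da² , X+4≡1b² , U≡ab) =
        ¬smaller-unit {d} fundamental odd-b odd-a (norm+4 (trans b²≡X+4 (cong (_+ 4) X≡da²))) 2≤da² b<2+X a≤U
        where
        b²≡X+4 : b * b ≡ X + 4
        b²≡X+4 = trans (sym (*-identityˡ (b * b))) (sym X+4≡1b²)
        odd-b : Odd b
        odd-b = odd-*ˡ (subst Odd (sym b²≡X+4) (odd-+4 odd-X))
        odd-a : Odd a
        odd-a = odd-*ˡ (odd-*ʳ {d} (subst Odd X≡da² odd-X))
        instance
          b≢0 : NonZero b
          b≢0 = >-nonZero (odd⇒n>0 odd-b)
          a²≢0 : NonZero (a * a)
          a²≢0 = >-nonZero (*-mono-< (odd⇒n>0 odd-a) (odd⇒n>0 odd-a))
        2≤da² : 2 ≤ d * (a * a)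
        2≤da² = ≤-trans (≤-trans (nonTrivial⇒n>1 p₁ {{prime⇒nonTrivial p₁-prime}}) (m≤m*n p₁ p₂ {{prime⇒nonZero p₂-prime}}))
                        (m≤m*n d (a * a))
        b<2+X : b < 2 + X
        b<2+X = m*m<n*n⇒m<n (subst (_< (2 + X) * (2 + X)) (sym b²≡X+4) (X+4<[2+X]² X (odd⇒n>0 odd-X)))
        a≤U : a ≤ U
        a≤U = subst (a ≤_) (sym U≡ab) (m≤m*n a b)

    d∣X+4⇒⊥ : d ∣ X + 4 → ⊥
    d∣X+4⇒⊥ d∣X+4 = refute (coprime-split {m = 1} {n = d} {k = U} {{m*n≢0 1 d}} coprime (1∣ X) d∣X+4
                               (trans X[X+4]≡dU² (cong (_* (U * U)) (sym (*-identityˡ d)))))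
      where
      refute : (∃₂ λ b a → X ≡ 1 * (b * b) × X + 4 ≡ d * (a * a) × U ≡ b * a) → ⊥
      refute (b , a , X≡1b² , X+4≡da² , U≡ba) =
        ¬smaller-unit {d} fundamental odd-b odd-a (norm-4 (trans (cong (_+ 4) b²≡X) X+4≡da²)) 2≤da² b<2+X a≤U
        where
        b²≡X : b * b ≡ X
        b²≡X = trans (sym (*-identityˡ (b * b))) (sym X≡1b²)
        odd-b : Odd b
        odd-b = odd-*ˡ (subst Odd (sym b²≡X) odd-X)
        odd-a : Odd a
        odd-a = odd-*ˡ (odd-*ʳ {d} (subst Odd X+4≡da² (odd-+4 odd-X)))
        instance
          b≢0 : NonZero b
          b≢0 = >-nonZero (odd⇒n>0 odd-b)
        2≤da² : 2 ≤ d * (a * a)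
        2≤da² = subst (2 ≤_) X+4≡da² (≤-trans (s≤s (s≤s z≤n)) (m≤n+m 4 X))
        b<2+X : b < 2 + X
        b<2+X = s≤s (≤-trans (subst (b ≤_) b²≡X (m≤m*n b b)) (n≤1+n X))
        a≤U : a ≤ U
        a≤U = subst (a ≤_) (sym U≡ba) (m≤n*m a b)

    4∣X+1 : p₁ ≢ p₂ → p₁ % 4 ≡ 3 → p₂ % 4 ≡ 3 → 4 ∣ X + 1
    4∣X+1 p₁≢p₂ p₁%4≡3 p₂%4≡3
      with euclidsLemma X (X + 4) p₁-prime p₁∣X[X+4] | euclidsLemma X (X + 4) p₂-prime p₂∣X[X+4]
      where
      p₁∣X[X+4] : p₁ ∣ X * (X + 4)
      p₁∣X[X+4] = subst (p₁ ∣_) (sym X[X+4]≡dU²) (∣m⇒∣m*n (U * U) (m∣m*n p₂))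
      p₂∣X[X+4] : p₂ ∣ X * (X + 4)
      p₂∣X[X+4] = subst (p₂ ∣_) (sym X[X+4]≡dU²) (∣m⇒∣m*n (U * U) (n∣m*n p₁))
    ... | inj₁ p₁∣X   | inj₁ p₂∣X   = ⊥-elim (d∣X⇒⊥ (p∣n∧q∣n⇒pq∣n p₁-prime p₂-prime p₁≢p₂ p₁∣X p₂∣X))
    ... | inj₂ p₁∣X+4 | inj₂ p₂∣X+4 = ⊥-elim (d∣X+4⇒⊥ (p∣n∧q∣n⇒pq∣n p₁-prime p₂-prime p₁≢p₂ p₁∣X+4 p₂∣X+4))
    ... | inj₁ p₁∣X   | inj₂ p₂∣X+4 = split⇒4∣n+1 {k = U} p₂%4≡3 odd-X p₁∣X p₂∣X+4 X[X+4]≡dU²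
    ... | inj₂ p₁∣X+4 | inj₁ p₂∣X   =
      split⇒4∣n+1 {k = U} {{m*n≢0 p₂ p₁ {{prime⇒nonZero p₂-prime}} {{prime⇒nonZero p₁-prime}}}}
        p₁%4≡3 odd-X p₂∣X p₁∣X+4 (trans X[X+4]≡dU² (cong (_* (U * U)) (*-comm p₁ p₂)))

  odd-trace≡1[mod4] : ∀ {p₁ p₂ T U} → Prime p₁ → Prime p₂ → p₁ ≢ p₂ → p₁ % 4 ≡ 3 → p₂ % 4 ≡ 3 →
                      IsFundamentalUnit (+ (p₁ * p₂)) (+ T) (+ U) → (+ T) ≡ (+ 1) [mod (+ 2) ] →
                      T * T ≡ p₁ * p₂ * (U * U) + 4 → (+ T) ≡ (+ 1) [mod (+ 4) ]
  odd-trace≡1[mod4] {T = zero} _ _ _ _ _ _ 2∣1 _ with ∣1⇒≡1 2∣1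
  ... | ()
  odd-trace≡1[mod4] {T = suc zero} _ _ _ _ _ _ _ _ = 4 ∣0
  odd-trace≡1[mod4] {p₁} {p₂} {suc (suc X)} {U} p₁-prime p₂-prime p₁≢p₂ p₁%4≡3 p₂%4≡3 fundamental 2∣1+X T²≡dU²+4 =
    subst (4 ∣_) (+-comm X 1)
      (4∣X+1 p₁-prime p₂-prime fundamental (2∣1+n⇒odd 2∣1+X) X[X+4]≡dU² p₁≢p₂ p₁%4≡3 p₂%4≡3)
    where
    expand : ∀ X → X * (X + 4) + 4 ≡ (2 + X) * (2 + X)
    expand = solve-∀
    X[X+4]≡dU² : X * (X + 4) ≡ p₁ * p₂ * (U * U)
    X[X+4]≡dU² = +-cancelʳ-≡ 4 _ _ (trans (expand X) T²≡dU²+4)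


open import Defs
open import Data.Nat as ℕ using (ℕ)
open import Data.Nat.Primality using (Prime)
open import Data.Integer using (ℤ; +_; _<_; 0ℤ)
open import Relation.Binary.PropositionalEquality using (_≡_; _≢_; subst; sym)
open import Data.Nat.Divisibility using (_∣_; ∣m⇒∣m*n; m∣m*n)
open import Data.Product using (proj₁)
open import Data.Empty using (⊥-elim)
open FermatLittle using (p∤x²+4)
open QuadraticUnits using (unit⇒norm±4; norm+4; norm-4)
open FundamentalUnit using (odd-trace≡1[mod4])

lemma3p11 : (p₁ p₂ : ℕ) → Prime p₁ → Prime p₂ → p₁ ≢ p₂
    → p₁ ℕ.% 4 ≡ 3 → p₂ ℕ.% 4 ≡ 3 → (p₁ ℕ.* p₂) ℕ.% 8 ≡ 5
    → (t u : ℤ) → 0ℤ < t → 0ℤ < u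
    → IsFundamentalUnit (+ (p₁ ℕ.* p₂)) t u
    → t ≡ + 1 [mod + 2 ] → u ≡ + 1 [mod + 2 ]
    → t ≡ + 1 [mod + 4 ]
lemma3p11 p₁ p₂ p₁-prime p₂-prime p₁≢p₂ p₁%4≡3 p₂%4≡3 _ (+ T) (+ U) _ _ fundamental t-odd _
  with unit⇒norm±4 {p₁ ℕ.* p₂} {T} {U} (proj₁ fundamental)
... | norm-4 T²+4≡dU² =
  ⊥-elim (p∤x²+4 p₁-prime p₁%4≡3 T (subst (p₁ ∣_) (sym T²+4≡dU²) (∣m⇒∣m*n (U ℕ.* U) (m∣m*n p₂))))
... | norm+4 T²≡dU²+4 =
  odd-trace≡1[mod4] p₁-prime p₂-prime p₁≢p₂ p₁%4≡3 p₂%4≡3 fundamental t-odd T²≡dU²+4
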